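{- For integers $C\geq 2$ and $k\in\{1,\dots,C-1\}$, $\gamma_{P,k}(WKP_{(C,2)})= C-k$.
   Context: For a graph $G$, $S\subseteq V(G)$ and an integer $k\ge 0$, define $\mathcal{P}^0_{G,k}(S)=N_G[S]$ (closed neighbourhood of $S$) and $\mathcal{P}^{i+1}_{G,k}(S)=\bigcup\{N_G[v] : v\in \mathcal{P}^i_{G,k}(S),\ |N_G[v]\setminus \mathcal{P}^i_{G,k}(S)|\le k\}$. These sets increase and stabilize at a set $\mathcal{P}^\infty_{G,k}(S)$. A $k$-power dominating set ($k$-PDS) is a set $S$ with $\mathcal{P}^\infty_{G,k}(S)=V(G)$, and $\gamma_{P,k}(G)$ is the minimum cardinality of a $k$-PDS of $G$. Let $[C]_0=\{0,\dots,C-1\}$. The WK-Pyramid network $WKP_{(C,L)}$ has vertex set $\{(r,(a_r a_{r-1}\cdots a_1)) : r\in\{1,\dots,L\},\ a_i\in[C]_0\}\cup\{(0,(1))\}$; a vertex $(r,(a_r\cdots a_1))$ is said to be at level $r$. The vertex $(0,(1))$ is adjacent to every vertex at level $1$. A vertex $(r,(a_r\cdots a_1))$ with $r>0$ is adjacent to: (1) the vertices $(r,(a_r\cdots a_2 b))$ with $b\in[C]_0$, $b\ne a_1$; (2) the vertex $(r,(a_r\cdots a_{j+1}a_{j-1}(a_j)^{j-1}))$ if there is a $j$ with $2\le j\le r$, $a_{j-1}=a_{j-2}=\cdots=a_1$ and $a_j\ne a_{j-1}$, where $(a_j)^{j-1}$ denotes $a_j$ repeated $j-1$ times; (3) the vertices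 $(r+1,(a_r\cdots a_1 b))$ for $b\in[C]_0$ (when $r<L$); (4) the vertex $(r-1,(a_r\cdots a_2))$ (for $r=1$ this is $(0,(1))$). -}

module Defs where

open import Data.Nat using (ℕ; zero; suc; _+_; _∸_; _≤_; _≤ᵇ_; _≡ᵇ_)
open import Data.Fin using (Fin)
open import Data.Fin.Properties using () renaming (_≟_ to _≟F_)
open import Data.List using (List; []; _∷_; map; concatMap; upTo; length; replicate; _++_; filterᵇ; allFin)
open import Data.Bool.ListAction using (any)
open import Data.List.Properties using (≡-dec)
open import Data.List.Relation.Unary.All using (All)
open import Data.List.Relation.Unary.Unique.Propositional using (Unique)
open import Data.List.Membership.Propositional using (_∈_)
open import Data.Bool using (Bool; true; false; _∧_; _∨_; not; if_then_else_)
open import Data.Maybe using (Maybe; just; nothing)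
open import Data.Product using (Σ; ∃; _×_)
open import Relation.Nullary.Decidable using (⌊_⌋)
open import Relation.Binary.PropositionalEquality using (_≡_)

-- A word (a_r a_{r-1} ... a_1) is stored as the list a_1 ∷ a_2 ∷ ... ∷ a_r
-- (i.e. REVERSED: head = a_1 = last digit).  The level of node w is length w.
-- apex is the vertex (0,(1)).

data V (C : ℕ) : Set where
  apex : V C
  node : List (Fin C) → V C

_=F_ : {C : ℕ} → Fin C → Fin C → Bool
a =F b = ⌊ a ≟F b ⌋

_=W_ : {C : ℕ} → List (Fin C) → List (Fin C) → Bool
w =W w' = ⌊ ≡-dec _≟F_ w w' ⌋

_=V_ : {C : ℕ} → V C → V C → Bool
apex   =V apex    = true
apex   =V node _  = false
node _ =V apex    = false
node w =V node w' = w =W w'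

words : (C r : ℕ) → List (List (Fin C))
words C zero    = [] ∷ []
words C (suc r) = concatMap (λ w → map (λ b → b ∷ w) (allFin C)) (words C r)

vertices : (C L : ℕ) → List (V C)
vertices C L = apex ∷ concatMap (λ r → map node (words C (suc r))) (upTo L)

-- Rule (2): for w = a_1 … a_r (reversed) with a_1 = … = a_{j-1} ≠ a_j,
-- the neighbour has a_{j-1} at position j and a_j at positions 1..j-1.
-- run a n xs : a run of n copies of a has been read, xs is the rest.
swapRun : {C : ℕ} → Fin C → ℕ → List (Fin C) → Maybe (List (Fin C))
swapRun a n []       = nothing
swapRun a n (x ∷ xs) = if x =F a then swapRun a (suc n) xs
                                 else just (replicate n x ++ (a ∷ xs))

rule2 : {C : ℕ} → List (Fin C) → Maybe (List (Fin C))
rule2 []       = nothing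
rule2 (a ∷ xs) = swapRun a 1 xs

maybeEq : {C : ℕ} → Maybe (List (Fin C)) → List (Fin C) → Bool
maybeEq nothing  w' = false
maybeEq (just w) w' = w =W w'

-- directed version of rules (1)-(4) from the definition, from u to v
arc : {C : ℕ} → V C → V C → Bool
arc apex     apex      = false
arc apex     (node w)  = length w ≡ᵇ 1
arc (node w) apex      = length w ≡ᵇ 1                      -- rule (4), r = 1
arc (node w) (node w') = r1 w w' ∨ maybeEq (rule2 w) w' ∨ r3 w w' ∨ r4 w w'
  where
  -- rule (1): differ exactly in the last digit a_1
  r1 : _ → _ → Bool
  r1 (a ∷ t) (b ∷ t') = not (a =F b) ∧ (t =W t')
  r1 _       _        = false
  -- rule (3): child (r+1, a_r … a_1 b)
  r3 : _ → _ → Bool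
  r3 w (b ∷ t') = t' =W w
  r3 w []       = false
  -- rule (4): parent (r-1, a_r … a_2), r ≥ 2
  r4 : _ → _ → Bool
  r4 (a ∷ t) w' = (1 ≤ᵇ length t) ∧ (t =W w')
  r4 []      w' = false

adj : {C : ℕ} → V C → V C → Bool
adj u v = arc u v ∨ arc v u

inN : {C : ℕ} → V C → V C → Bool
inN v u = (v =V u) ∨ adj v u

-- k-power domination on WKP(C,L); sets of vertices are Bool predicates,
-- only ever evaluated on vertices of the graph.

countᵇ : {A : Set} → (A → Bool) → List A → ℕ
countᵇ p xs = length (filterᵇ p xs)

P : (C L k : ℕ) → List (V C) → ℕ → V C → Bool
P C L k S zero    u = any (λ s → inN s u) S
P C L k S (suc i) u =
  any (λ v → P C L k S i v
           ∧ (countᵇ (λ x → inN v x ∧ not (P C L k S i x)) (vertices C L) ≤ᵇ k)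
           ∧ inN v u)
      (vertices C L)

-- S is a k-power dominating set of WKP(C,L): S ⊆ V(G) and 𝒫^∞ = V(G)
-- (𝒫^∞ is the union of the increasing chain 𝒫^i, so this means some 𝒫^i is everything).
IsKPDS : (C L k : ℕ) → List (V C) → Set
IsKPDS C L k S = All (_∈ vertices C L) S
               × ∃ λ i → All (λ u → P C L k S i u ≡ true) (vertices C L)

γPk≡ : (C L k m : ℕ) → Set
γPk≡ C L k m =
  (Σ (List (V C)) λ S → Unique S × IsKPDS C L k S × length S ≡ m)
  × ((S : List (V C)) → Unique S → IsKPDS C L k S → m ≤ length S)

-- Upper bound: take the C - k level-1 vertices (1,(a)) with a a "chosen" letter.
-- They observe the apex, level 1 and every (2,(a b)) with a chosen.  For a
-- chosen and b not, (2,(a b)) then has (2,(b a)) as its only unobserved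
-- neighbour (rule (2)) and forces it; afterwards (2,(b a₀)), for a fixed chosen
-- a₀, sees exactly the k vertices (2,(b c)) with c not chosen, and forces them.
-- Lower bound: a vertex adjacent to (2,(c d)) is its parent (1,(c)), a sibling
-- (2,(c f)) or (2,(d c)), so its level-1 ancestor is c or d.  If |S| < C - k,
-- some set F of k + 1 letters contains no ancestor of a vertex of S, and no
-- (2,(c d)) with c, d ∈ F is ever observed: the parent and siblings always see
-- the k + 1 unobserved vertices (2,(c d′)), d′ ∈ F, so they cannot force, and
-- (2,(d c)) is of the same kind.

module Submission where

open import Defs
open import Data.Nat using (ℕ; zero; suc; _+_; _∸_; _≤_; _<_; _≤ᵇ_; z≤n; s≤s)
open import Data.Nat.Properties
  using (≤-refl; ≤-reflexive; ≤-trans; <-≤-trans; ≤-<-trans; <⇒≱; ≮⇒≥; ≤⇒≤ᵇ; ≤ᵇ⇒≤;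
         suc-injective; +-monoʳ-≤; +-cancelʳ-<; m∸n+n≡m; +-∸-assoc; m≤n+o⇒m∸n≤o)
open import Data.Fin using (Fin; _↑ˡ_; _↑ʳ_; splitAt) renaming (zero to fzero)
open import Data.Fin.Properties
  using (splitAt-↑ˡ; splitAt-↑ʳ; splitAt⁻¹-↑ˡ; splitAt⁻¹-↑ʳ; ↑ˡ-injective; ↑ʳ-injective)
  renaming (_≟_ to _≟F_)
open import Data.List
  using (List; []; _∷_; [_]; map; concatMap; upTo; length; _++_; filter; filterᵇ; allFin; last; mapMaybe)
open import Data.List.Properties
  using (∷-injectiveˡ; length-map; length-++; length-tabulate; length-removeAt′; length-mapMaybe)
open import Data.List.Relation.Unary.All as All using (All; []; _∷_)
import Data.List.Relation.Unary.All.Properties as All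
open import Data.List.Relation.Unary.Any as Any using (Any; here; there; _─_; index)
open import Data.List.Relation.Unary.Any.Properties using (any⁺; any⁻; gmap; mapMaybe⁺)
open import Data.List.Relation.Unary.AllPairs as AllPairs using ([]; _∷_)
import Data.List.Relation.Unary.AllPairs.Properties as AllPairs
open import Data.List.Relation.Unary.Unique.Propositional using (Unique)
import Data.List.Relation.Unary.Unique.Propositional.Properties as Unique
open import Data.List.Relation.Binary.Disjoint.Propositional using (Disjoint)
open import Data.List.Relation.Binary.Subset.Propositional using (_⊆_)
open import Data.List.Membership.Propositional using (_∈_; _∉_; find; lose)
open import Data.List.Membership.Propositional.Properties
  using (∈-map⁺; ∈-map⁻; ∈-++⁺ˡ; ∈-++⁺ʳ; ∈-allFin; ∈-concatMap⁺; ∈-concatMap⁻;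
         ∈-upTo⁺; ∈-upTo⁻; ∈-filter⁺; ∈-filter⁻)
import Data.List.Membership.DecPropositional as DecMembership
open import Data.Bool using (Bool; true; false; _∧_; _∨_; not; T)
open import Data.Bool.Properties using (T-∧; T-∨; T-≡)
open import Data.Maybe using (Maybe; just; nothing)
import Data.Maybe.Relation.Unary.Any as Maybe
open import Data.Empty using (⊥-elim)
open import Data.Product using (Σ; ∃; ∃₂; _×_; _,_; proj₂)
open import Data.Sum using (_⊎_; inj₁; inj₂)
open import Function using (_∘_; Equivalence)
open import Relation.Nullary using (¬_; Dec; yes; no)
open import Relation.Nullary.Decidable using (toWitness; fromWitness; fromWitnessFalse; T?)
open import Relation.Binary.PropositionalEquality using (_≡_; _≢_; refl; sym; trans; cong; subst; subst₂)

-- The operand that the argument does not determine is passed explicitly: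
-- x ∨ y with x unknown does not reduce, so Agda cannot match it against a
-- stuck disjunction.
private
  T-∨⁺ˡ : ∀ {x y} → T x → T (x ∨ y)
  T-∨⁺ˡ = Equivalence.from T-∨ ∘ inj₁

  T-∨⁺ʳ : ∀ x {y} → T y → T (x ∨ y)
  T-∨⁺ʳ _ = Equivalence.from T-∨ ∘ inj₂

  T-∨⁻ : ∀ x {y} → T (x ∨ y) → T x ⊎ T y
  T-∨⁻ _ = Equivalence.to T-∨

  T-∧⁺ : ∀ {x y} → T x → T y → T (x ∧ y)
  T-∧⁺ tx ty = Equivalence.from T-∧ (tx , ty)

  T-∧⁻ : ∀ x {y} → T (x ∧ y) → T x × T y
  T-∧⁻ _ = Equivalence.to T-∧

  T-not⁻ : ∀ {x} → T (not x) → ¬ T x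
  T-not⁻ {false} _ ()

  T-not⁺ : ∀ {x} → ¬ T x → T (not x)
  T-not⁺ {false} _ = _
  T-not⁺ {true} ¬t = ¬t _

module _ {A : Set} where

  ∈-─ : ∀ {x z} {ys : List A} (x∈ys : x ∈ ys) → z ∈ ys → z ≢ x → z ∈ (ys ─ x∈ys)
  ∈-─ (here refl) (here refl) z≢x = ⊥-elim (z≢x refl)
  ∈-─ (here refl) (there z∈ys) _  = z∈ys
  ∈-─ (there _)   (here refl)  _  = here refl
  ∈-─ (there x∈ys) (there z∈ys) z≢x = there (∈-─ x∈ys z∈ys z≢x)

  Unique⇒length≤ : ∀ {xs ys : List A} → Unique xs → xs ⊆ ys → length xs ≤ length ys
  Unique⇒length≤ []                     _      = z≤n
  Unique⇒length≤ {ys = ys} (x∉xs ∷ xs!) xs⊆ys =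
    subst (_ ≤_) (sym (length-removeAt′ ys (index x∈ys)))
      (s≤s (Unique⇒length≤ xs! λ z∈xs →
        ∈-─ x∈ys (xs⊆ys (there z∈xs)) λ { refl → All.lookup x∉xs z∈xs refl }))
    where x∈ys = xs⊆ys (here refl)

module _ {C : ℕ} where

  node-injective : ∀ {w w′ : List (Fin C)} → node w ≡ node w′ → w ≡ w′
  node-injective refl = refl

  extensions : List (Fin C) → List (List (Fin C))
  extensions w = map (_∷ w) (allFin C)

  ∈-words⁺ : (w : List (Fin C)) → w ∈ words C (length w)
  ∈-words⁺ []      = here refl
  ∈-words⁺ (a ∷ w) = ∈-concatMap⁺ extensions {xs = words C (length w)}
    (Any.map (λ { refl → ∈-map⁺ (_∷ w) (∈-allFin a) }) (∈-words⁺ w))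

  ∈-words⁻ : ∀ r {w} → w ∈ words C r → length w ≡ r
  ∈-words⁻ zero    (here refl) = refl
  ∈-words⁻ (suc r) w∈
    with w′ , w′∈ , w∈ext ← find (∈-concatMap⁻ extensions {xs = words C r} w∈)
    with _ , _ , refl ← ∈-map⁻ (_∷ w′) w∈ext
    = cong suc (∈-words⁻ r w′∈)

  words-unique : ∀ r → Unique (words C r)
  words-unique zero    = [] ∷ []
  words-unique (suc r) =
    Unique.concat⁺
      (All.map⁺ (All.universal (λ _ → Unique.map⁺ (λ { refl → refl }) (Unique.allFin⁺ C)) (words C r)))
      (AllPairs.map⁺ (AllPairs.map disjoint (words-unique r)))
    where
    disjoint : ∀ {w w′} → w ≢ w′ → Disjoint (extensions w) (extensions w′)
    disjoint w≢w′ (v∈ , v∈′)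
      with _ , _ , refl ← ∈-map⁻ (_∷ _) v∈
      with _ , _ , refl ← ∈-map⁻ (_∷ _) v∈′ = w≢w′ refl

  level : ℕ → List (V C)
  level r = map node (words C (suc r))

  levels : ℕ → List (V C)
  levels L = concatMap level (upTo L)

  ∈-levels⁻ : ∀ {L u} → u ∈ levels L → ∃₂ λ a t → u ≡ node (a ∷ t) × length t < L
  ∈-levels⁻ {L} u∈
    with r , r∈ , u∈r ← find (∈-concatMap⁻ level {xs = upTo L} u∈)
    with w , w∈ , refl ← ∈-map⁻ node u∈r
    with a ∷ t ← w | refl ← ∈-words⁻ (suc r) w∈
    = a , t , refl , ∈-upTo⁻ r∈

  ∈-vertices⁺ : ∀ {L} a t → length t < L → node (a ∷ t) ∈ vertices C L
  ∈-vertices⁺ {L} a t |t|<L = there (∈-concatMap⁺ level {xs = upTo L}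
    (Any.map (λ { refl → ∈-map⁺ node (∈-words⁺ (a ∷ t)) }) (∈-upTo⁺ |t|<L)))

  vertices-unique : ∀ L → Unique (vertices C L)
  vertices-unique L =
    All.tabulate apex∉ ∷
    Unique.concat⁺
      (All.map⁺ (All.universal (λ r → Unique.map⁺ node-injective (words-unique (suc r))) (upTo L)))
      (AllPairs.map⁺ (AllPairs.map disjoint (Unique.upTo⁺ L)))
    where
    apex∉ : ∀ {u} → u ∈ levels L → apex ≢ u
    apex∉ u∈ apex≡u with _ , _ , refl , _ ← ∈-levels⁻ {L} u∈ with () ← apex≡u
    disjoint : ∀ {r r′} → r ≢ r′ → Disjoint (level r) (level r′)
    disjoint r≢r′ (u∈ , u∈′)
      with w , w∈ , refl ← ∈-map⁻ node u∈
      with w′ , w′∈ , w≡w′ ← ∈-map⁻ node u∈′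
      = r≢r′ (suc-injective (trans (sym (∈-words⁻ _ w∈))
                             (trans (cong length (node-injective w≡w′)) (∈-words⁻ _ w′∈))))

  level₁∈ : ∀ e → node (e ∷ []) ∈ vertices C 2
  level₁∈ e = ∈-vertices⁺ {L = 2} e [] (s≤s z≤n)

  level₂∈ : ∀ f e → node (f ∷ e ∷ []) ∈ vertices C 2
  level₂∈ f e = ∈-vertices⁺ {L = 2} f (e ∷ []) ≤-refl

  data Vertex₂ : V C → Set where
    apex   : Vertex₂ apex
    level₁ : (e : Fin C) → Vertex₂ (node (e ∷ []))
    level₂ : (f e : Fin C) → Vertex₂ (node (f ∷ e ∷ []))

  vertex₂ : ∀ {u} → u ∈ vertices C 2 → Vertex₂ u
  vertex₂ (here refl) = apex
  vertex₂ (there u∈) with a , t , refl , |t|<2 ← ∈-levels⁻ {2} u∈ = shape a t |t|<2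
    where
    shape : ∀ a t → length t < 2 → Vertex₂ (node (a ∷ t))
    shape a []          _                 = level₁ a
    shape a (e ∷ [])    _                 = level₂ a e
    shape a (_ ∷ _ ∷ _) (s≤s (s≤s ()))

module _ {C : ℕ} where

  =W⇒≡ : (w w′ : List (Fin C)) → T (w =W w′) → w ≡ w′
  =W⇒≡ w w′ = toWitness

  =W-refl : (w : List (Fin C)) → T (w =W w)
  =W-refl w = fromWitness refl

  rule2-pair⁺ : (f e : Fin C) → e ≢ f → T (maybeEq (rule2 (f ∷ e ∷ [])) (e ∷ f ∷ []))
  rule2-pair⁺ f e e≢f with e ≟F f
  ... | yes e≡f = ⊥-elim (e≢f e≡f)
  ... | no _    = =W-refl (e ∷ f ∷ [])

  rule2-pair⁻ : (f e : Fin C) (w : List (Fin C)) → T (maybeEq (rule2 (f ∷ e ∷ [])) w) → w ≡ e ∷ f ∷ []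
  rule2-pair⁻ f e w h with e ≟F f
  ... | yes _ = ⊥-elim h
  ... | no _  = sym (=W⇒≡ (e ∷ f ∷ []) w h)

  inN-refl : (v : V C) → T (inN v v)
  inN-refl apex     = _
  inN-refl (node w) = T-∨⁺ˡ (=W-refl w)

  inN-sibling : (f d : Fin C) (t : List (Fin C)) → T (inN (node (f ∷ t)) (node (d ∷ t)))
  inN-sibling f d t = by-cases (f ≟F d)
    where
    by-cases : Dec (f ≡ d) → T (inN (node (f ∷ t)) (node (d ∷ t)))
    by-cases (yes f≡d) = subst (λ a → T (inN (node (f ∷ t)) (node (a ∷ t)))) f≡d (inN-refl (node (f ∷ t)))
    by-cases (no f≢d)  = T-∨⁺ʳ ((f ∷ t) =W (d ∷ t))
      (T-∨⁺ˡ (T-∨⁺ˡ (T-∧⁺ (fromWitnessFalse {a? = f ≟F d} f≢d) (=W-refl t))))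

  inN-child : (w : List (Fin C)) (d : Fin C) → T (inN (node w) (node (d ∷ w)))
  inN-child []      _ = _
  inN-child (a ∷ t) d = T-∨⁺ʳ ((a ∷ t) =W (d ∷ a ∷ t)) (T-∨⁺ˡ
    (T-∨⁺ʳ (not (a =F d) ∧ (t =W (a ∷ t)))
      (T-∨⁺ʳ (maybeEq (rule2 (a ∷ t)) (d ∷ a ∷ t)) (T-∨⁺ˡ (=W-refl (a ∷ t))))))

  inN-swap : (f e : Fin C) → e ≢ f → T (inN (node (f ∷ e ∷ [])) (node (e ∷ f ∷ [])))
  inN-swap f e e≢f = T-∨⁺ʳ ((f ∷ e ∷ []) =W (e ∷ f ∷ [])) (T-∨⁺ˡ
    (T-∨⁺ʳ (not (f =F e) ∧ ((e ∷ []) =W (f ∷ []))) (T-∨⁺ˡ (rule2-pair⁺ f e e≢f))))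

  -- The disjuncts of arc are rules (1), (2), (3), (4), in this order.
  arc₂₂⁻ : (f e d c : Fin C) → T (arc (node (f ∷ e ∷ [])) (node (d ∷ c ∷ []))) →
           c ≡ e ⊎ (d ≡ e × c ≡ f)
  arc₂₂⁻ f e d c h with T-∨⁻ (not (f =F d) ∧ ((e ∷ []) =W (c ∷ []))) h
  ... | inj₁ h₁ with refl ← =W⇒≡ (e ∷ []) (c ∷ []) (proj₂ (T-∧⁻ (not (f =F d)) h₁)) = inj₁ refl
  ... | inj₂ h₂ with T-∨⁻ (maybeEq (rule2 (f ∷ e ∷ [])) (d ∷ c ∷ [])) h₂
  ...   | inj₁ h₃ with refl ← rule2-pair⁻ f e (d ∷ c ∷ []) h₃ = inj₂ (refl , refl)
  ...   | inj₂ h₄ with T-∨⁻ ((c ∷ []) =W (f ∷ e ∷ [])) h₄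
  ...     | inj₁ h₅ with () ← =W⇒≡ (c ∷ []) (f ∷ e ∷ []) h₅
  ...     | inj₂ h₆ with () ← =W⇒≡ (e ∷ []) (d ∷ c ∷ []) h₆

  arc₁₂⁻ : (e d c : Fin C) → T (arc (node (e ∷ [])) (node (d ∷ c ∷ []))) → c ≡ e
  arc₁₂⁻ e d c h with T-∨⁻ (not (e =F d) ∧ ([] =W (c ∷ []))) h
  ... | inj₁ h₁ = ⊥-elim (proj₂ (T-∧⁻ (not (e =F d)) h₁))
  ... | inj₂ h₂ with T-∨⁻ ((c ∷ []) =W (e ∷ [])) h₂
  ...   | inj₁ h₃ with refl ← =W⇒≡ (c ∷ []) (e ∷ []) h₃ = refl
  ...   | inj₂ ()

  arc₂₁⁻ : (d c e : Fin C) → T (arc (node (d ∷ c ∷ [])) (node (e ∷ []))) → c ≡ e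
  arc₂₁⁻ d c e h with T-∨⁻ (not (d =F e) ∧ ((c ∷ []) =W [])) h
  ... | inj₁ h₁ = ⊥-elim (proj₂ (T-∧⁻ (not (d =F e)) h₁))
  ... | inj₂ h₂ with T-∨⁻ (maybeEq (rule2 (d ∷ c ∷ [])) (e ∷ [])) h₂
  ...   | inj₁ h₃ with () ← rule2-pair⁻ d c (e ∷ []) h₃
  ...   | inj₂ h₄ with refl ← =W⇒≡ (c ∷ []) (e ∷ []) h₄ = refl

  inN₂₂⁻ : (f e d c : Fin C) → T (inN (node (f ∷ e ∷ [])) (node (d ∷ c ∷ []))) →
           c ≡ e ⊎ (d ≡ e × c ≡ f)
  inN₂₂⁻ f e d c h with T-∨⁻ ((f ∷ e ∷ []) =W (d ∷ c ∷ [])) h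
  ... | inj₁ h₁ with refl ← =W⇒≡ (f ∷ e ∷ []) (d ∷ c ∷ []) h₁ = inj₁ refl
  ... | inj₂ h₂ with T-∨⁻ (arc (node (f ∷ e ∷ [])) (node (d ∷ c ∷ []))) h₂
  ...   | inj₁ h₃ = arc₂₂⁻ f e d c h₃
  ...   | inj₂ h₄ with arc₂₂⁻ d c f e h₄
  ...     | inj₁ refl         = inj₁ refl
  ...     | inj₂ (refl , refl) = inj₂ (refl , refl)

  inN₁₂⁻ : (e d c : Fin C) → T (inN (node (e ∷ [])) (node (d ∷ c ∷ []))) → c ≡ e
  inN₁₂⁻ e d c h with T-∨⁻ ((e ∷ []) =W (d ∷ c ∷ [])) h
  ... | inj₁ h₁ with () ← =W⇒≡ (e ∷ []) (d ∷ c ∷ []) h₁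
  ... | inj₂ h₂ with T-∨⁻ (arc (node (e ∷ [])) (node (d ∷ c ∷ []))) h₂
  ...   | inj₁ h₃ = arc₁₂⁻ e d c h₃
  ...   | inj₂ h₄ = arc₂₁⁻ d c e h₄

  -- node (d ∷ c ∷ []) is the vertex (2,(c d)).
  data Nbhd₂ (d c : Fin C) : V C → Set where
    parent  : Nbhd₂ d c (node (c ∷ []))
    sibling : (f : Fin C) → Nbhd₂ d c (node (f ∷ c ∷ []))
    swap    : Nbhd₂ d c (node (c ∷ d ∷ []))

  nbhd₂ : ∀ {v d c} → v ∈ vertices C 2 → T (inN v (node (d ∷ c ∷ []))) → Nbhd₂ d c v
  nbhd₂ {d = d} {c} v∈ h with vertex₂ v∈
  ... | level₁ e with refl ← inN₁₂⁻ e d c h = parent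
  ... | level₂ f e with inN₂₂⁻ f e d c h
  ...   | inj₁ refl          = sibling f
  ...   | inj₂ (refl , refl) = swap

-- The propagation rule

module Propagation (C L k : ℕ) (S : List (V C)) where

  𝒫 : ℕ → V C → Bool
  𝒫 = P C L k S

  unobservedNbr : ℕ → V C → V C → Bool
  unobservedNbr i v x = inN v x ∧ not (𝒫 i x)

  unobservedNbrs : ℕ → V C → List (V C)
  unobservedNbrs i v = filterᵇ (unobservedNbr i v) (vertices C L)

  unobservedNbrs-unique : ∀ i v → Unique (unobservedNbrs i v)
  unobservedNbrs-unique i v = Unique.filter⁺ (T? ∘ unobservedNbr i v) (vertices-unique L)

  ∈-unobservedNbrs⁺ : ∀ {i v x} → x ∈ vertices C L → T (inN v x) → ¬ T (𝒫 i x) →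
                      x ∈ unobservedNbrs i v
  ∈-unobservedNbrs⁺ {i} {v} x∈V adj ¬obs =
    ∈-filter⁺ (T? ∘ unobservedNbr i v) x∈V (T-∧⁺ adj (T-not⁺ ¬obs))

  ∈-unobservedNbrs⁻ : ∀ {i v x} → x ∈ unobservedNbrs i v →
                      x ∈ vertices C L × T (inN v x) × ¬ T (𝒫 i x)
  ∈-unobservedNbrs⁻ {i} {v} {x} x∈
    with x∈V , h ← ∈-filter⁻ (T? ∘ unobservedNbr i v) {xs = vertices C L} x∈
    with adj , ¬obs ← T-∧⁻ (inN v x) h
    = x∈V , adj , T-not⁻ ¬obs

  forcedBy : ℕ → V C → V C → Bool
  forcedBy i u v = 𝒫 i v ∧ (length (unobservedNbrs i v) ≤ᵇ k) ∧ inN v u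

  𝒫-zero⁺ : ∀ {s u} → s ∈ S → T (inN s u) → T (𝒫 0 u)
  𝒫-zero⁺ {u = u} s∈S adj = any⁺ (λ s → inN s u) (lose s∈S adj)

  𝒫-zero⁻ : ∀ {u} → T (𝒫 0 u) → ∃ λ s → s ∈ S × T (inN s u)
  𝒫-zero⁻ obs = find (any⁻ _ S obs)

  𝒫-suc⁺ : ∀ {i v u} → v ∈ vertices C L → T (𝒫 i v) → length (unobservedNbrs i v) ≤ k →
           T (inN v u) → T (𝒫 (suc i) u)
  𝒫-suc⁺ {i} {u = u} v∈V obs few adj =
    any⁺ (forcedBy i u) (lose v∈V (T-∧⁺ obs (T-∧⁺ (≤⇒≤ᵇ few) adj)))

  𝒫-suc⁻ : ∀ {i u} → T (𝒫 (suc i) u) →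
           ∃ λ v → v ∈ vertices C L × T (𝒫 i v) × length (unobservedNbrs i v) ≤ k × T (inN v u)
  𝒫-suc⁻ {i} {u} obs
    with v , v∈V , h ← find (any⁻ (forcedBy i u) (vertices C L) obs)
    with v-obs , h′ ← T-∧⁻ (𝒫 i v) h
    with few , adj ← T-∧⁻ (length (unobservedNbrs i v) ≤ᵇ k) h′
    = v , v∈V , v-obs , ≤ᵇ⇒≤ _ k few , adj

  module _ (S⊆V : All (_∈ vertices C L) S) where

    private
      saturated-forces : ∀ {i v u} → v ∈ vertices C L → T (𝒫 i v) →
                         (∀ {x} → T (inN v x) → T (𝒫 i x)) → T (inN v u) → T (𝒫 (suc i) u)
      saturated-forces {i} {v} {u} v∈V obs all-obs =
        𝒫-suc⁺ {i} {u = u} v∈V obs (≤-trans (Unique⇒length≤ (unobservedNbrs-unique i v) none) z≤n)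
        where
        none : unobservedNbrs i v ⊆ []
        none x∈ with _ , adj , ¬obs ← ∈-unobservedNbrs⁻ {i} {v} x∈ = ⊥-elim (¬obs (all-obs adj))

    -- 𝒫 (suc i) is made of neighbourhoods of forcing vertices only; an observed
    -- vertex whose whole neighbourhood is observed forces with nothing left.
    𝒫-mono : ∀ {i u} → T (𝒫 i u) → T (𝒫 (suc i) u)
    𝒫-mono {zero} {u} obs with s , s∈S , adj ← 𝒫-zero⁻ obs =
      saturated-forces {0} {s} {u} (All.lookup S⊆V s∈S) (𝒫-zero⁺ s∈S (inN-refl s)) (𝒫-zero⁺ s∈S) adj
    𝒫-mono {suc i} {u} obs with v , v∈V , v-obs , few , adj ← 𝒫-suc⁻ {i} obs =
      saturated-forces {suc i} {v} {u} v∈V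
        (𝒫-suc⁺ {i} v∈V v-obs few (inN-refl v)) (𝒫-suc⁺ {i} v∈V v-obs few) adj

-- A dominating set of size C - k

data Split (m n : ℕ) : Fin (m + n) → Set where
  left  : (i : Fin m) → Split m n (i ↑ˡ n)
  right : (j : Fin n) → Split m n (m ↑ʳ j)

split : ∀ m {n} (a : Fin (m + n)) → Split m n a
split m {n} a with splitAt m a in eq
... | inj₁ i = subst (Split m n) (splitAt⁻¹-↑ˡ eq) (left i)
... | inj₂ j = subst (Split m n) (splitAt⁻¹-↑ʳ eq) (right j)

↑ˡ≢↑ʳ : ∀ {m n} (i : Fin m) (j : Fin n) → i ↑ˡ n ≢ m ↑ʳ j
↑ˡ≢↑ʳ {m} {n} i j eq
  with () ← trans (sym (splitAt-↑ˡ m i n)) (trans (cong (splitAt m) eq) (splitAt-↑ʳ m n j))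

module UpperBound (m k : ℕ) (1≤k : 1 ≤ k) where

  C : ℕ
  C = suc m + k

  chosen : Fin (suc m) → Fin C
  chosen i = i ↑ˡ k

  other : Fin k → Fin C
  other j = suc m ↑ʳ j

  S : List (V C)
  S = map (λ i → node (chosen i ∷ [])) (allFin (suc m))

  chosen∈S : ∀ i → node (chosen i ∷ []) ∈ S
  chosen∈S i = ∈-map⁺ (λ i → node (chosen i ∷ [])) (∈-allFin i)

  S⊆V : All (_∈ vertices C 2) S
  S⊆V = All.map⁺ (All.universal (λ i → level₁∈ (chosen i)) (allFin (suc m)))

  S-unique : Unique S
  S-unique =
    Unique.map⁺ (λ eq → ↑ˡ-injective k _ _ (∷-injectiveˡ (node-injective eq))) (Unique.allFin⁺ (suc m))

  length-S : length S ≡ suc m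
  length-S = trans (length-map (λ i → node (chosen i ∷ [])) (allFin (suc m))) (length-tabulate (λ i → i))

  open Propagation C 2 k S

  observed-apex : T (𝒫 0 apex)
  observed-apex = 𝒫-zero⁺ {u = apex} (chosen∈S fzero) _

  observed-level₁ : ∀ c → T (𝒫 0 (node (c ∷ [])))
  observed-level₁ c = 𝒫-zero⁺ (chosen∈S fzero) (inN-sibling (chosen fzero) c [])

  observed-under-chosen : ∀ i d → T (𝒫 0 (node (d ∷ chosen i ∷ [])))
  observed-under-chosen i d = 𝒫-zero⁺ (chosen∈S i) (inN-child (chosen i ∷ []) d)

  unobserved₀ : ∀ {x} → x ∈ vertices C 2 → ¬ T (𝒫 0 x) →
                ∃₂ λ d j → x ≡ node (d ∷ other j ∷ [])
  unobserved₀ x∈ ¬obs with vertex₂ x∈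
  ... | apex       = ⊥-elim (¬obs observed-apex)
  ... | level₁ c   = ⊥-elim (¬obs (observed-level₁ c))
  ... | level₂ d c with split (suc m) c
  ...   | left i  = ⊥-elim (¬obs (observed-under-chosen i d))
  ...   | right j = d , j , refl

  observed-swap : ∀ i j → T (𝒫 1 (node (chosen i ∷ other j ∷ [])))
  observed-swap i j =
    𝒫-suc⁺ {0} (level₂∈ (other j) (chosen i)) (observed-under-chosen i (other j))
      (≤-trans (Unique⇒length≤ (unobservedNbrs-unique 0 v) only-swap) 1≤k)
      (inN-swap (other j) (chosen i) (↑ˡ≢↑ʳ i j))
    where
    v = node (other j ∷ chosen i ∷ [])
    only-swap : unobservedNbrs 0 v ⊆ [ node (chosen i ∷ other j ∷ []) ]
    only-swap x∈
      with x∈V , adj , ¬obs ← ∈-unobservedNbrs⁻ {0} {v} x∈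
      with d , j′ , refl ← unobserved₀ x∈V ¬obs
      with inN₂₂⁻ (other j) (chosen i) d (other j′) adj
    ... | inj₁ other≡chosen = ⊥-elim (↑ˡ≢↑ʳ i j′ (sym other≡chosen))
    ... | inj₂ (refl , other≡other) with refl ← ↑ʳ-injective (suc m) j′ j other≡other = here refl

  unobserved₁ : ∀ {x} → x ∈ vertices C 2 → ¬ T (𝒫 1 x) →
                ∃₂ λ j′ j → x ≡ node (other j′ ∷ other j ∷ [])
  unobserved₁ {x} x∈ ¬obs
    with d , j , refl ← unobserved₀ x∈ (¬obs ∘ 𝒫-mono S⊆V {0} {x})
    with split (suc m) d
  ... | left i   = ⊥-elim (¬obs (observed-swap i j))
  ... | right j′ = j′ , j , refl

  observed₂ : ∀ {x} → x ∈ vertices C 2 → T (𝒫 2 x)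
  observed₂ {x} x∈ with T? (𝒫 1 x)
  ... | yes obs = 𝒫-mono S⊆V {1} {x} obs
  ... | no ¬obs with j′ , j , refl ← unobserved₁ x∈ ¬obs =
    𝒫-suc⁺ {1} (level₂∈ (chosen fzero) (other j)) (observed-swap fzero j)
      (≤-trans (Unique⇒length≤ (unobservedNbrs-unique 1 v) ⊆block) (≤-reflexive length-block))
      (inN-sibling (chosen fzero) (other j′) (other j ∷ []))
    where
    v = node (chosen fzero ∷ other j ∷ [])
    block = map (λ j′ → node (other j′ ∷ other j ∷ [])) (allFin k)
    length-block : length block ≡ k
    length-block =
      trans (length-map (λ j′ → node (other j′ ∷ other j ∷ [])) (allFin k)) (length-tabulate (λ j′ → j′))
    ⊆block : unobservedNbrs 1 v ⊆ block
    ⊆block y∈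
      with y∈V , adj , ¬obs′ ← ∈-unobservedNbrs⁻ {1} {v} y∈
      with a , b , refl ← unobserved₁ y∈V ¬obs′
      with inN₂₂⁻ (chosen fzero) (other j) (other a) (other b) adj
    ... | inj₁ b≡j with refl ← ↑ʳ-injective (suc m) b j b≡j =
      ∈-map⁺ (λ j′ → node (other j′ ∷ other j ∷ [])) (∈-allFin a)
    ... | inj₂ (_ , b≡chosen) = ⊥-elim (↑ˡ≢↑ʳ fzero b (sym b≡chosen))

  isKPDS : IsKPDS C 2 k S
  isKPDS = S⊆V , 2 , All.tabulate (Equivalence.to T-≡ ∘ observed₂)

-- No dominating set of size less than C - k

module _ {C : ℕ} where

  -- Words are stored reversed, so the last letter is a_r: the level-1 ancestor.
  root : V C → Maybe (Fin C)
  root apex     = nothing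
  root (node w) = last w

  roots : List (V C) → List (Fin C)
  roots = mapMaybe root

  ∈-roots : ∀ {S s a} → s ∈ S → root s ≡ just a → a ∈ roots S
  ∈-roots {S} s∈S root≡a =
    mapMaybe⁺ root S (gmap (λ { refl → subst (Maybe.Any (_ ≡_)) (sym root≡a) (Maybe.just refl) }) s∈S)

  fresh-letters : ∀ {k} (I : List (Fin C)) → k + length I < C →
                  Σ (List (Fin C)) λ F → Unique F × k < length F × All (_∉ I) F
  fresh-letters {k} I k+|I|<C =
    F , Unique.filter⁺ (_∉? I) (Unique.allFin⁺ C) ,
    +-cancelʳ-< _ _ _ (<-≤-trans k+|I|<C C≤) , All.all-filter (_∉? I) (allFin C)
    where
    open DecMembership _≟F_ using (_∈?_; _∉?_)
    F = filter (_∉? I) (allFin C)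
    cover : allFin C ⊆ F ++ I
    cover {a} _ with a ∈? I
    ... | yes a∈I = ∈-++⁺ʳ F a∈I
    ... | no a∉I  = ∈-++⁺ˡ (∈-filter⁺ (_∉? I) (∈-allFin a) a∉I)
    C≤ : C ≤ length F + length I
    C≤ = subst₂ _≤_ (length-tabulate (λ a → a)) (length-++ F) (Unique⇒length≤ (Unique.allFin⁺ C) cover)

module Unobservable {C k : ℕ} {S : List (V C)} (S⊆V : All (_∈ vertices C 2) S)
                    {F : List (Fin C)} (F-unique : Unique F) (k<|F| : k < length F)
                    (F-fresh : All (_∉ roots S) F) where

  open Propagation C 2 k S

  crowded : ∀ {i v c} → (∀ {d} → d ∈ F → ¬ T (𝒫 i (node (d ∷ c ∷ [])))) →
            (∀ d → T (inN v (node (d ∷ c ∷ [])))) → k < length (unobservedNbrs i v)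
  crowded {i} {v} {c} unobserved adj =
    <-≤-trans k<|F| (subst (_≤ _) (length-map block F)
      (Unique⇒length≤ (Unique.map⁺ (∷-injectiveˡ ∘ node-injective) F-unique) block⊆))
    where
    block : Fin C → V C
    block d = node (d ∷ c ∷ [])
    block⊆ : map block F ⊆ unobservedNbrs i v
    block⊆ x∈ with d , d∈F , refl ← ∈-map⁻ block x∈ =
      ∈-unobservedNbrs⁺ {i} {v} (level₂∈ d c) (adj d) (unobserved d∈F)

  never-observed : ∀ i {d c} → d ∈ F → c ∈ F → ¬ T (𝒫 i (node (d ∷ c ∷ [])))
  never-observed zero d∈F c∈F obs
    with s , s∈S , adj ← 𝒫-zero⁻ obs
    with nbhd₂ (All.lookup S⊆V s∈S) adj
  ... | parent    = All.lookup F-fresh c∈F (∈-roots s∈S refl)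
  ... | sibling _ = All.lookup F-fresh c∈F (∈-roots s∈S refl)
  ... | swap      = All.lookup F-fresh d∈F (∈-roots s∈S refl)
  never-observed (suc i) {d} {c} d∈F c∈F obs
    with v , v∈V , v-obs , few , adj ← 𝒫-suc⁻ {i} obs
    with nbhd₂ v∈V adj
  ... | parent    = <⇒≱ (crowded {i} {node (c ∷ [])} {c} (λ d′∈F → never-observed i d′∈F c∈F)
                                 (λ d′ → inN-child (c ∷ []) d′)) few
  ... | sibling f = <⇒≱ (crowded {i} {node (f ∷ c ∷ [])} {c} (λ d′∈F → never-observed i d′∈F c∈F)
                                 (λ d′ → inN-sibling f d′ (c ∷ []))) few
  ... | swap      = never-observed i c∈F d∈F v-obs

no-small-kPDS : ∀ {C k} {S : List (V C)} → k + length S < C → ¬ IsKPDS C 2 k S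
no-small-kPDS {C} {k} {S} small (S⊆V , i , observed)
  with fresh-letters (roots S) (≤-<-trans (+-monoʳ-≤ k (length-mapMaybe root S)) small)
... | [] , _ , () , _
... | d ∷ F , F-unique , k<|F| , F-fresh =
  Unobservable.never-observed S⊆V F-unique k<|F| F-fresh i (here refl) (here refl)
    (Equivalence.from T-≡ (All.lookup observed (level₂∈ d d)))

kPDS-length≥ : ∀ {C k} {S : List (V C)} → IsKPDS C 2 k S → C ∸ k ≤ length S
kPDS-length≥ {C} {k} K = m≤n+o⇒m∸n≤o C k (≮⇒≥ λ small → no-small-kPDS small K)

mainTheorem4 : (C k : ℕ) → 2 ≤ C → 1 ≤ k → k ≤ C ∸ 1 → γPk≡ C 2 k (C ∸ k)
mainTheorem4 (suc n) k _ 1≤k k≤n =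
  subst₂ (λ C m → Σ (List (V C)) λ S → Unique S × IsKPDS C 2 k S × length S ≡ m)
    (cong suc (m∸n+n≡m k≤n)) (sym (+-∸-assoc 1 k≤n))
    (S , S-unique , isKPDS , length-S) ,
  λ _ _ → kPDS-length≥
  where open UpperBound (n ∸ k) k 1≤k
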